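{- Let $q$ be a prime power and $k,m$ positive integers. Let $H$ be an $\mathbb{F}_{q^m}$-hyperplane of $\mathbb{F}_{q^m}^{k+1}$, and let $W\subseteq H$ be an $\mathbb{F}_q$-subspace of $\mathbb{F}_q$-dimension $t$ which is a linear cutting blocking set in $H$, i.e. $\langle W\rangle_{\mathbb{F}_{q^m}}=H$ and $\langle H'\cap W\rangle_{\mathbb{F}_{q^m}}=H'$ for every $\mathbb{F}_{q^m}$-hyperplane $H'$ of $H$. Let $v\in\mathbb{F}_{q^m}^{k+1}\setminus H$. Then $U=W+\langle v\rangle_{\mathbb{F}_{q^m}}$ is a cutting $[t+m,k+1]_{q^m/q}$ system.
   Context: An $[n,k]_{q^m/q}$ system is an $\mathbb{F}_q$-subspace $U\subseteq\mathbb{F}_{q^m}^k$ with $\dim_{\mathbb{F}_q}(U)=n$ and $\langle U\rangle_{\mathbb{F}_{q^m}}=\mathbb{F}_{q^m}^k$. It is cutting if for every $\mathbb{F}_{q^m}$-hyperplane $\Pi$ of $\mathbb{F}_{q^m}^k$ one has $\langle \Pi\cap U\rangle_{\mathbb{F}_{q^m}}=\Pi$. -}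

module Defs where

open import Level using (0ℓ)
open import Algebra.Bundles using (CommutativeRing)
open import Data.Nat using (ℕ; zero; suc; _^_; _≤_)
open import Data.Nat as N using ()
open import Data.Nat.Primality using (Prime)
open import Data.Fin using (Fin; zero; suc)
open import Data.Product using (Σ; ∃; ∃-syntax; _×_; _,_)
open import Data.Unit using (⊤)
open import Relation.Nullary using (¬_)
open import Relation.Unary using (Pred; _⊆_; _∩_)
open import Relation.Binary.PropositionalEquality using (_≡_)

IsPrimePower : ℕ → Set
IsPrimePower q = ∃[ p ] ∃[ e ] (Prime p × 1 ≤ e × q ≡ p ^ e)

-- Linear algebra over a commutative ring F (to be a field), with
-- coefficients restricted to a sub-predicate ("subfield") of F.
module Lin (F : CommutativeRing 0ℓ 0ℓ) where
  open CommutativeRing F using (_≈_; _+_; _*_; -_; 0#; 1#) renaming (Carrier to C)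

  IsField : Set
  IsField = (¬ (1# ≈ 0#)) × (∀ x → ¬ (x ≈ 0#) → ∃[ y ] (x * y ≈ 1#))

  IsSubfield : Pred C 0ℓ → Set
  IsSubfield K =
    (∀ {x y} → x ≈ y → K x → K y) × K 0# × K 1#
    × (∀ {x y} → K x → K y → K (x + y))
    × (∀ {x y} → K x → K y → K (x * y))
    × (∀ {x} → K x → K (- x))
    × (∀ {x} → K x → ¬ (x ≈ 0#) → ∀ y → x * y ≈ 1# → K y)

  HasCard : Pred C 0ℓ → ℕ → Set
  HasCard K q = Σ (Fin q → C) λ f →
    (∀ i → K (f i)) × (∀ i j → f i ≈ f j → i ≡ j) × (∀ x → K x → ∃[ i ] (f i ≈ x))

  sum : ∀ {d} → (Fin d → C) → C
  sum {zero} f = 0#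
  sum {suc d} f = f zero + sum (λ i → f (suc i))

  ExtDegree : Pred C 0ℓ → ℕ → Set
  ExtDegree K m = Σ (Fin m → C) λ b →
    (∀ (c : Fin m → C) → (∀ i → K (c i)) → sum {m} (λ i → c i * b i) ≈ 0# → ∀ i → c i ≈ 0#)
    × (∀ x → Σ (Fin m → C) λ c → ((∀ i → K (c i)) × x ≈ sum {m} (λ i → c i * b i)))

  V : ℕ → Set
  V n = Fin n → C

  _≈v_ : ∀ {n} → V n → V n → Set
  x ≈v y = ∀ j → x j ≈ y j

  0v : ∀ {n} → V n
  0v _ = 0#

  _+v_ : ∀ {n} → V n → V n → V n
  (x +v y) j = x j + y j

  _·_ : ∀ {n} → C → V n → V n
  (a · x) j = a * x j

  lc : ∀ {n d} → (Fin d → C) → (Fin d → V n) → V n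
  lc c b j = sum (λ i → c i * b i j)

  All : Pred C 0ℓ
  All _ = ⊤

  Whole : ∀ {n} → Pred (V n) 0ℓ
  Whole _ = ⊤

  _≐_ : ∀ {n} → Pred (V n) 0ℓ → Pred (V n) 0ℓ → Set
  A ≐ B = (A ⊆ B) × (B ⊆ A)

  -- S is a K-subspace (K = All gives F-subspaces)
  IsSubspace : ∀ {n} → Pred C 0ℓ → Pred (V n) 0ℓ → Set
  IsSubspace K S =
    (∀ {x y} → x ≈v y → S x → S y) × S 0v
    × (∀ {x y} → S x → S y → S (x +v y))
    × (∀ {a x} → K a → S x → S (a · x))

  HasDim : ∀ {n} → Pred C 0ℓ → Pred (V n) 0ℓ → ℕ → Set
  HasDim {n} K S d = IsSubspace K S × Σ (Fin d → V n) λ b →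
    (∀ i → S (b i))
    × (∀ (c : Fin d → C) → (∀ i → K (c i)) → lc c b ≈v 0v → ∀ i → c i ≈ 0#)
    × (∀ x → S x → Σ (Fin d → C) λ c → ((∀ i → K (c i)) × x ≈v lc c b))

  Span : ∀ {n} → Pred (V n) 0ℓ → Pred (V n) 0ℓ
  Span {n} S x = ∃[ d ] Σ (Fin d → C) λ c → Σ (Fin d → V n) λ b →
    (∀ i → S (b i)) × x ≈v lc c b

  IsHyperplaneOf : ∀ {n} → Pred (V n) 0ℓ → Pred (V n) 0ℓ → Set
  IsHyperplaneOf Π S = (Π ⊆ S) × ∃[ d ] (HasDim All S (suc d) × HasDim All Π d)

  _⊕⟨_⟩ : ∀ {n} → Pred (V n) 0ℓ → V n → Pred (V n) 0ℓ
  (W ⊕⟨ v ⟩) x = ∃[ w ] ∃[ a ] (W w × x ≈v (w +v (a · v)))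

  IsSystem : Pred C 0ℓ → (n k : ℕ) → Pred (V k) 0ℓ → Set
  IsSystem K n k U = HasDim K U n × (Whole ⊆ Span U)

  IsCuttingSystem : Pred C 0ℓ → (n k : ℕ) → Pred (V k) 0ℓ → Set₁
  IsCuttingSystem K n k U = IsSystem K n k U ×
    (∀ (Π : Pred (V k) 0ℓ) → IsHyperplaneOf Π Whole → Span (Π ∩ U) ≐ Π)

-- Equality with 0 in F is decidable, since F is spanned by finitely many elements over the finite
-- field K; so Gaussian elimination is available: more than n vectors of F^n are dependent, and a
-- hyperplane Π of F^n is the kernel of a linear form g.  A K-basis of W followed by e_j v, for an
-- F/K-basis e, is a K-basis of U = W + ⟨v⟩, independent because v ∉ H.  Every x equals h + a v with
-- h ∈ H.  If g v ≠ 0, projecting each w ∈ W along v into Π lands in Π ∩ U, and these projections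
-- span Π.  If g v = 0, then v ∈ Π ∩ U, and Π ∩ H is either H or a hyperplane of H; in both cases
-- Π ∩ H is spanned by Π ∩ W (the latter by the cutting property of W in H).
module Submission where

open import Defs
open import Level using (0ℓ)
open import Algebra.Bundles using (CommutativeRing)
open import Data.Nat as ℕ using (ℕ; zero; suc; _≤_; z≤n; s≤s)
open import Data.Nat.Properties using (_≤?_; ≰⇒>; m≤n⇒m≤1+n; ≤-refl)
open import Data.Fin using (Fin; zero; suc; _≟_; punchIn; splitAt; _↑ˡ_; _↑ʳ_)
open import Data.Fin.Properties using (join-splitAt; any?; all?)
open import Data.Vec.Functional using (_∷_; tail; _++_; take; drop; insertAt; removeAt)
open import Data.Vec.Functional.Properties
  using (lookup-++ˡ; lookup-++ʳ; insertAt-lookup; insertAt-punchIn)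
import Data.Vec.Functional.Relation.Unary.All.Properties as AllV
open import Data.Sum.Properties using ([,]-∘)
open import Data.Product using (Σ; ∃-syntax; _×_; _,_; proj₁; proj₂)
open import Data.Empty using (⊥-elim)
open import Data.Unit using (tt)
open import Function using (_∘_; _$_)
open import Relation.Nullary using (¬_; Dec; yes; no; ¬?)
open import Relation.Nullary.Decidable using (decidable-stable)
open import Relation.Unary using (Pred; _⊆_; _∩_)
open import Relation.Binary.PropositionalEquality as ≡ using (_≡_)
import Algebra.Properties.Semiring.Sum as SemiringSum
import Algebra.Properties.Ring as RingProperties
import Algebra.Properties.Group as GroupProperties
import Algebra.Properties.CommutativeSemigroup as CommutativeSemigroupProperties
import Relation.Binary.Reasoning.Setoid as SetoidReasoning

take++drop : ∀ {A : Set} m {n} (xs : Fin (m ℕ.+ n) → A) i → (take m xs ++ drop m xs) i ≡ xs i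
take++drop m {n} xs i = ≡.trans (≡.sym ([,]-∘ xs (splitAt m i))) (≡.cong xs (join-splitAt m n i))

module LinearAlgebra (F : CommutativeRing 0ℓ 0ℓ) where
  open CommutativeRing F hiding (zero) renaming (Carrier to C)
  open Lin F
  open RingProperties ring using (-‿distribˡ-*; -‿distribʳ-*)
  open CommutativeSemigroupProperties *-commutativeSemigroup using (x∙yz≈y∙xz; xy∙z≈xz∙y; xy∙z≈yz∙x)
  open CommutativeSemigroupProperties +-commutativeSemigroup using (interchange)
  open SetoidReasoning setoid
  private module ∑ = SemiringSum semiring

  x≈0⇒x*y+z≈z : ∀ {x y z} → x ≈ 0# → x * y + z ≈ z
  x≈0⇒x*y+z≈z {x} {y} {z} x≈0 = trans (+-congʳ (trans (*-congʳ x≈0) (zeroˡ y))) (+-identityˡ z)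

  sum≡∑ : ∀ {n} (f : Fin n → C) → sum f ≡ ∑.sum f
  sum≡∑ {zero} f = ≡.refl
  sum≡∑ {suc n} f = ≡.cong (f zero +_) (sum≡∑ (f ∘ suc))

  sum-cong : ∀ {n} {f g : Fin n → C} → (∀ i → f i ≈ g i) → sum f ≈ sum g
  sum-cong {f = f} {g} f≈g = begin
    sum f   ≡⟨ sum≡∑ f ⟩
    ∑.sum f ≈⟨ ∑.sum-cong-≋ f≈g ⟩
    ∑.sum g ≡⟨ sum≡∑ g ⟨
    sum g   ∎

  sum-zero : ∀ {n} {f : Fin n → C} → (∀ i → f i ≈ 0#) → sum f ≈ 0#
  sum-zero {n} {f} f≈0 = begin
    sum f                ≈⟨ sum-cong f≈0 ⟩
    sum {n} (λ _ → 0#)   ≡⟨ sum≡∑ {n} (λ _ → 0#) ⟩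
    ∑.sum {n} (λ _ → 0#) ≈⟨ ∑.sum-replicate-zero n ⟩
    0#                   ∎

  sum-+ : ∀ {n} (f g : Fin n → C) → sum (λ i → f i + g i) ≈ sum f + sum g
  sum-+ f g = begin
    sum (λ i → f i + g i)   ≡⟨ sum≡∑ (λ i → f i + g i) ⟩
    ∑.sum (λ i → f i + g i) ≈⟨ ∑.∑-distrib-+ f g ⟩
    ∑.sum f + ∑.sum g       ≡⟨ ≡.cong₂ _+_ (sum≡∑ f) (sum≡∑ g) ⟨
    sum f + sum g           ∎

  *-distribˡ-sum : ∀ {n} x (f : Fin n → C) → x * sum f ≈ sum (λ i → x * f i)
  *-distribˡ-sum x f = begin
    x * sum f             ≡⟨ ≡.cong (x *_) (sum≡∑ f) ⟩
    x * ∑.sum f           ≈⟨ ∑.*-distribˡ-sum x f ⟩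
    ∑.sum (λ i → x * f i) ≡⟨ sum≡∑ (λ i → x * f i) ⟨
    sum (λ i → x * f i)   ∎

  *-distribʳ-sum : ∀ {n} x (f : Fin n → C) → sum f * x ≈ sum (λ i → f i * x)
  *-distribʳ-sum x f = begin
    sum f * x             ≡⟨ ≡.cong (_* x) (sum≡∑ f) ⟩
    ∑.sum f * x           ≈⟨ ∑.*-distribʳ-sum x f ⟩
    ∑.sum (λ i → f i * x) ≡⟨ sum≡∑ (λ i → f i * x) ⟨
    sum (λ i → f i * x)   ∎

  sum-comm : ∀ {m n} (f : Fin m → Fin n → C) →
    sum (λ i → sum (λ j → f i j)) ≈ sum (λ j → sum (λ i → f i j))
  sum-comm f = begin
    sum (λ i → sum (f i))             ≡⟨ sum≡∑ (λ i → sum (f i)) ⟩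
    ∑.sum (λ i → sum (f i))           ≡⟨ ∑.sum-cong-≗ (λ i → sum≡∑ (f i)) ⟩
    ∑.sum (λ i → ∑.sum (f i))         ≈⟨ ∑.∑-comm f ⟩
    ∑.sum (λ j → ∑.sum (λ i → f i j)) ≡⟨ ∑.sum-cong-≗ (λ j → sum≡∑ (λ i → f i j)) ⟨
    ∑.sum (λ j → sum (λ i → f i j))   ≡⟨ sum≡∑ (λ j → sum (λ i → f i j)) ⟨
    sum (λ j → sum (λ i → f i j))     ∎

  sum-removeAt : ∀ {n} (f : Fin (suc n) → C) p → sum f ≈ f p + sum (removeAt f p)
  sum-removeAt f p = begin
    sum f                      ≡⟨ sum≡∑ f ⟩
    ∑.sum f                    ≈⟨ ∑.sum-remove f ⟩
    f p + ∑.sum (removeAt f p) ≡⟨ ≡.cong (f p +_) (sum≡∑ (removeAt f p)) ⟨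
    f p + sum (removeAt f p)   ∎

  sum-take-drop : ∀ m {n} (f : Fin (m ℕ.+ n) → C) → sum f ≈ sum (take m f) + sum (drop m f)
  sum-take-drop zero f = sym (+-identityˡ _)
  sum-take-drop (suc m) f = trans (+-congˡ (sum-take-drop m (f ∘ suc))) (sym (+-assoc _ _ _))

  ≈v-sym : ∀ {n} {x y : V n} → x ≈v y → y ≈v x
  ≈v-sym x≈y j = sym (x≈y j)

  ≈v-trans : ∀ {n} {x y z : V n} → x ≈v y → y ≈v z → x ≈v z
  ≈v-trans x≈y y≈z j = trans (x≈y j) (y≈z j)

  +v-cong : ∀ {n} {x x' y y' : V n} → x ≈v x' → y ≈v y' → (x +v y) ≈v (x' +v y')
  +v-cong x≈x' y≈y' j = +-cong (x≈x' j) (y≈y' j)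

  ·-congˡ : ∀ {n} {a b} (x : V n) → a ≈ b → (a · x) ≈v (b · x)
  ·-congˡ x a≈b j = *-congʳ a≈b

  +v-comm : ∀ {n} (x y : V n) → (x +v y) ≈v (y +v x)
  +v-comm x y j = +-comm (x j) (y j)

  ·+·-cancel : ∀ {n} (x : V n) {a b} u → a + b ≈ 0# → ((x +v (a · u)) +v (b · u)) ≈v x
  ·+·-cancel x {a} {b} u a+b≈0 j = begin
    (x j + a * u j) + b * u j ≈⟨ +-assoc _ _ _ ⟩
    x j + (a * u j + b * u j) ≈⟨ +-congˡ (distribʳ (u j) a b) ⟨
    x j + (a + b) * u j       ≈⟨ +-congˡ (trans (*-congʳ a+b≈0) (zeroˡ (u j))) ⟩
    x j + 0#                  ≈⟨ +-identityʳ (x j) ⟩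
    x j                       ∎

  lc-cong : ∀ {n d} {c c' : Fin d → C} (b : Fin d → V n) → (∀ i → c i ≈ c' i) → lc c b ≈v lc c' b
  lc-cong b c≈c' j = sum-cong (λ i → *-congʳ (c≈c' i))

  lc-congʳ : ∀ {n d} (c : Fin d → C) {b b' : Fin d → V n} → (∀ i → b i ≈v b' i) → lc c b ≈v lc c b'
  lc-congʳ c b≈b' j = sum-cong (λ i → *-congˡ (b≈b' i j))

  lc-zero : ∀ {n d} {c : Fin d → C} (b : Fin d → V n) → (∀ i → c i ≈ 0#) → lc c b ≈v 0v
  lc-zero b c≈0 j = sum-zero (λ i → trans (*-congʳ (c≈0 i)) (zeroˡ _))

  lc-lc : ∀ {n d e} (c : Fin e → C) (A : Fin e → Fin d → C) (b : Fin d → V n) →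
    lc c (λ k → lc (A k) b) ≈v lc (lc c A) b
  lc-lc {d = d} {e} c A b j = begin
    sum (λ k → c k * sum (λ i → A k i * b i j))
      ≈⟨ sum-cong (λ k → *-distribˡ-sum (c k) (λ i → A k i * b i j)) ⟩
    sum (λ k → sum (λ i → c k * (A k i * b i j)))
      ≈⟨ sum-comm (λ k i → c k * (A k i * b i j)) ⟩
    sum (λ i → sum (λ k → c k * (A k i * b i j)))
      ≈⟨ sum-cong {d} (λ i → sum-cong {e} (λ k → sym (*-assoc _ _ _))) ⟩
    sum (λ i → sum (λ k → c k * A k i * b i j))
      ≈⟨ sum-cong (λ i → *-distribʳ-sum (b i j) (λ k → c k * A k i)) ⟨
    sum (λ i → lc c A i * b i j) ∎

  lc-scalars : ∀ {n d} (c e : Fin d → C) (u : V n) → lc c (λ i → e i · u) ≈v (sum (λ i → c i * e i) · u)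
  lc-scalars {d = d} c e u j = begin
    sum (λ i → c i * (e i * u j)) ≈⟨ sum-cong {d} (λ i → sym (*-assoc _ _ _)) ⟩
    sum (λ i → c i * e i * u j)   ≈⟨ *-distribʳ-sum (u j) (λ i → c i * e i) ⟨
    sum (λ i → c i * e i) * u j   ∎

  lc-shift : ∀ {n d} (c a : Fin d → C) (b : Fin d → V n) (u : V n) →
    lc c (λ i → b i +v (a i · u)) ≈v (lc c b +v (sum (λ i → c i * a i) · u))
  lc-shift {d = d} c a b u j = begin
    sum (λ i → c i * (b i j + a i * u j))       ≈⟨ sum-cong (λ i → distribˡ (c i) _ _) ⟩
    sum (λ i → c i * b i j + c i * (a i * u j)) ≈⟨ sum-+ (λ i → c i * b i j) _ ⟩
    lc c b j + sum (λ i → c i * (a i * u j))    ≈⟨ +-congˡ (sum-cong {d} (λ i → sym (*-assoc _ _ _))) ⟩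
    lc c b j + sum (λ i → c i * a i * u j)      ≈⟨ +-congˡ (*-distribʳ-sum (u j) (λ i → c i * a i)) ⟨
    lc c b j + sum (λ i → c i * a i) * u j      ∎

  lc-take-drop : ∀ {n} d {e} (c : Fin (d ℕ.+ e) → C) (b₁ : Fin d → V n) (b₂ : Fin e → V n) →
    lc c (b₁ ++ b₂) ≈v (lc (take d c) b₁ +v lc (drop d c) b₂)
  lc-take-drop d c b₁ b₂ j = trans (sum-take-drop d _)
    (+-cong (sum-cong (λ i → *-congˡ (reflexive (≡.cong (_$ j) (lookup-++ˡ b₁ b₂ i)))))
            (sum-cong (λ i → *-congˡ (reflexive (≡.cong (_$ j) (lookup-++ʳ b₁ b₂ i))))))

  lc-++ : ∀ {n d e} (c : Fin d → C) (c' : Fin e → C) (b : Fin d → V n) (b' : Fin e → V n) →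
    lc (c ++ c') (b ++ b') ≈v (lc c b +v lc c' b')
  lc-++ {d = d} c c' b b' = ≈v-trans (lc-take-drop d (c ++ c') b b')
    (+v-cong (lc-cong b (λ i → reflexive (lookup-++ˡ c c' i))) (lc-cong b' (λ i → reflexive (lookup-++ʳ c c' i))))

  lc-removeAt : ∀ {n d} (c : Fin (suc d) → C) (b : Fin (suc d) → V n) p →
    lc c b ≈v (lc (removeAt c p) (removeAt b p) +v (c p · b p))
  lc-removeAt c b p j = trans (sum-removeAt (λ i → c i * b i j) p) (+-comm _ _)

  lc-insertAt : ∀ {n d} (c : Fin d → C) (b : Fin (suc d) → V n) p x →
    lc (insertAt c p x) b ≈v (lc c (removeAt b p) +v (x · b p))
  lc-insertAt c b p x = ≈v-trans (lc-removeAt (insertAt c p x) b p) (+v-cong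
    (lc-cong (removeAt b p) (λ i → reflexive (insertAt-punchIn c p x i)))
    (·-congˡ (b p) (reflexive (insertAt-lookup c p x))))

  Independent : ∀ {n d} → Pred C 0ℓ → (Fin d → V n) → Set
  Independent K b = ∀ c → (∀ i → K (c i)) → lc c b ≈v 0v → ∀ i → c i ≈ 0#

  Nontrivial : ∀ {d} → (Fin d → C) → Set
  Nontrivial c = ∃[ i ] ¬ c i ≈ 0#

  Dependent : ∀ {n d} → (Fin d → V n) → Set
  Dependent b = ∃[ c ] Nontrivial c × lc c b ≈v 0v

  Coordinates : ∀ {n d} → Pred C 0ℓ → (Fin d → V n) → V n → Set
  Coordinates {d = d} K b x = Σ (Fin d → C) λ c → (∀ i → K (c i)) × x ≈v lc c b

  lc-closed : ∀ {n d} {K : Pred C 0ℓ} {S : Pred (V n) 0ℓ} → IsSubspace K S →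
    (c : Fin d → C) (b : Fin d → V n) → (∀ i → K (c i)) → (∀ i → S (b i)) → S (lc c b)
  lc-closed {d = zero} (S-cong , S-0 , _) c b _ _ = S-cong (λ _ → refl) S-0
  lc-closed {d = suc d} S@(_ , _ , S-+ , S-·) c b Kc Sb =
    S-+ (S-· (Kc zero) (Sb zero)) (lc-closed S (c ∘ suc) (b ∘ suc) (Kc ∘ suc) (Sb ∘ suc))

  coordinates-closed : ∀ {n d} {K : Pred C 0ℓ} {S : Pred (V n) 0ℓ} {b : Fin d → V n} {x} →
    IsSubspace K S → (∀ i → S (b i)) → Coordinates K b x → S x
  coordinates-closed {b = b} S@(S-cong , _) Sb (c , Kc , x≈) = S-cong (≈v-sym x≈) (lc-closed S c b Kc Sb)

  ∩-isSubspace : ∀ {n} {K} {S T : Pred (V n) 0ℓ} → IsSubspace K S → IsSubspace K T → IsSubspace K (S ∩ T)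
  ∩-isSubspace (S-cong , S-0 , S-+ , S-·) (T-cong , T-0 , T-+ , T-·) =
    (λ x≈y (Sx , Tx) → S-cong x≈y Sx , T-cong x≈y Tx) , (S-0 , T-0) ,
    (λ (Sx , Tx) (Sy , Ty) → S-+ Sx Sy , T-+ Tx Ty) , (λ Ka (Sx , Tx) → S-· Ka Sx , T-· Ka Tx)

  ⊆-⊕ : ∀ {n} {W : Pred (V n) 0ℓ} v → W ⊆ W ⊕⟨ v ⟩
  ⊆-⊕ v {w} Ww = w , 0# , Ww , λ j → sym (trans (+-congˡ (zeroˡ (v j))) (+-identityʳ (w j)))

  ∈-⊕ : ∀ {n} {W : Pred (V n) 0ℓ} v → W 0v → (W ⊕⟨ v ⟩) v
  ∈-⊕ v W0 = 0v , 1# , W0 , λ j → sym (trans (+-identityˡ _) (*-identityˡ (v j)))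

  ⊕-isSubspace : ∀ {n} {K} {W : Pred (V n) 0ℓ} (v : V n) → IsSubspace K W → IsSubspace K (W ⊕⟨ v ⟩)
  ⊕-isSubspace {W = W} v (W-cong , W-0 , W-+ , W-·) = ⊕-cong , ⊕-0 , ⊕-+ , ⊕-·
    where
    ⊕-cong : ∀ {x y} → x ≈v y → (W ⊕⟨ v ⟩) x → (W ⊕⟨ v ⟩) y
    ⊕-cong x≈y (w , a , Ww , x≈) = w , a , Ww , ≈v-trans (≈v-sym x≈y) x≈
    ⊕-0 : (W ⊕⟨ v ⟩) 0v
    ⊕-0 = ⊆-⊕ v W-0
    ⊕-+ : ∀ {x y} → (W ⊕⟨ v ⟩) x → (W ⊕⟨ v ⟩) y → (W ⊕⟨ v ⟩) (x +v y)
    ⊕-+ (w , a , Ww , x≈) (w' , a' , Ww' , y≈) = w +v w' , a + a' , W-+ Ww Ww' , λ j → begin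
      _                                   ≈⟨ +-cong (x≈ j) (y≈ j) ⟩
      (w j + a * v j) + (w' j + a' * v j) ≈⟨ interchange _ _ _ _ ⟩
      (w j + w' j) + (a * v j + a' * v j) ≈⟨ +-congˡ (distribʳ (v j) a a') ⟨
      (w j + w' j) + (a + a') * v j       ∎
    ⊕-· : ∀ {b x} → _ → (W ⊕⟨ v ⟩) x → (W ⊕⟨ v ⟩) (b · x)
    ⊕-· {b} Kb (w , a , Ww , x≈) = b · w , b * a , W-· Kb Ww , λ j → begin
      _                       ≈⟨ *-congˡ (x≈ j) ⟩
      b * (w j + a * v j)     ≈⟨ distribˡ b _ _ ⟩
      b * w j + b * (a * v j) ≈⟨ +-congˡ (*-assoc b a (v j)) ⟨
      b * w j + b * a * v j   ∎

  span-cong : ∀ {n} {S : Pred (V n) 0ℓ} {x y} → x ≈v y → Span S x → Span S y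
  span-cong x≈y (d , c , b , Sb , x≈) = d , c , b , Sb , ≈v-trans (≈v-sym x≈y) x≈

  span-mono : ∀ {n} {S T : Pred (V n) 0ℓ} → S ⊆ T → Span S ⊆ Span T
  span-mono S⊆T (d , c , b , Sb , x≈) = d , c , b , S⊆T ∘ Sb , x≈

  span-⊆ : ∀ {n} {S T : Pred (V n) 0ℓ} → IsSubspace All T → S ⊆ T → Span S ⊆ T
  span-⊆ T@(T-cong , _) S⊆T (d , c , b , Sb , x≈) = T-cong (≈v-sym x≈) (lc-closed T c b _ (S⊆T ∘ Sb))

  span-· : ∀ {n} {S : Pred (V n) 0ℓ} {x} a → S x → Span S (a · x)
  span-· {x = x} a Sx = 1 , (λ _ → a) , (λ _ → x) , (λ _ → Sx) , λ j → sym (+-identityʳ _)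

  span-+ : ∀ {n} {S : Pred (V n) 0ℓ} {x y} → Span S x → Span S y → Span S (x +v y)
  span-+ {S = S} (d , c , b , Sb , x≈) (e , c' , b' , Sb' , y≈) =
    d ℕ.+ e , c ++ c' , b ++ b' , AllV.++⁺ S Sb Sb' , ≈v-trans (+v-cong x≈ y≈) (≈v-sym (lc-++ c c' b b'))

  span-⊕ : ∀ {n} {W : Pred (V n) 0ℓ} v → W 0v → (Span W) ⊕⟨ v ⟩ ⊆ Span (W ⊕⟨ v ⟩)
  span-⊕ {W = W} v W0 (h , a , SWh , x≈) = span-cong {S = U} (≈v-sym x≈)
    (span-+ {S = U} (span-mono (λ {w} → ⊆-⊕ {W = W} v {w}) SWh) (span-· {S = U} a (∈-⊕ {W = W} v W0)))
    where U = W ⊕⟨ v ⟩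

  ⊆⇒⊆-span-∩ : ∀ {n} {Π H W : Pred (V n) 0ℓ} → W ⊆ H → H ⊆ Span W → H ⊆ Π → H ⊆ Span (Π ∩ W)
  ⊆⇒⊆-span-∩ {Π = Π} {W = W} W⊆H H⊆SW H⊆Π Hx =
    span-mono {S = W} {T = Π ∩ W} (λ Ww → H⊆Π (W⊆H Ww) , Ww) (H⊆SW Hx)

  record IsLinear {n} (φ : V n → C) : Set where
    field
      φ-cong : ∀ {x y} → x ≈v y → φ x ≈ φ y
      +-homo : ∀ x y → φ (x +v y) ≈ φ x + φ y
      ·-homo : ∀ a x → φ (a · x) ≈ a * φ x

    0-homo : φ 0v ≈ 0#
    0-homo = trans (φ-cong (λ _ → sym (zeroˡ 0#))) (trans (·-homo 0# 0v) (zeroˡ _))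

    lc-homo : ∀ {d} (c : Fin d → C) b → φ (lc c b) ≈ sum (λ i → c i * φ (b i))
    lc-homo {zero} c b = 0-homo
    lc-homo {suc d} c b = trans (+-homo (c zero · b zero) (lc (c ∘ suc) (b ∘ suc)))
      (+-cong (·-homo (c zero) (b zero)) (lc-homo (c ∘ suc) (b ∘ suc)))

    lc-vanishes : ∀ {d} (c : Fin d → C) {b} → (∀ i → φ (b i) ≈ 0#) → φ (lc c b) ≈ 0#
    lc-vanishes c {b} φb≈0 = trans (lc-homo c b) (sum-zero λ i → trans (*-congˡ (φb≈0 i)) (zeroʳ (c i)))

  Ker : ∀ {n} → (V n → C) → Pred (V n) 0ℓ
  Ker φ x = φ x ≈ 0#

  dot : ∀ {n} → V n → V n → C
  dot g x = sum (λ i → g i * x i)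

  dot-isLinear : ∀ {n} (g : V n) → IsLinear (dot g)
  dot-isLinear {n} g = record
    { φ-cong = λ x≈y → sum-cong (λ i → *-congˡ (x≈y i))
    ; +-homo = λ x y → trans (sum-cong (λ i → distribˡ (g i) (x i) (y i))) (sum-+ (λ i → g i * x i) _)
    ; ·-homo = λ a x → trans (sum-cong {n} (λ i → x∙yz≈y∙xz (g i) a (x i)))
                             (sym (*-distribˡ-sum a (λ i → g i * x i)))
    }

  head-isLinear : ∀ {n} → IsLinear {suc n} (_$ zero)
  head-isLinear = record { φ-cong = _$ zero ; +-homo = λ _ _ → refl ; ·-homo = λ _ _ → refl }

  dot-unit : ∀ {n} (g : V (suc n)) i → dot g (insertAt (λ _ → 0#) i 1#) ≈ g i
  dot-unit g i = begin
    dot g e                                                   ≈⟨ sum-removeAt (λ j → g j * e j) i ⟩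
    g i * e i + sum (λ s → g (punchIn i s) * e (punchIn i s))
      ≈⟨ +-cong (*-congˡ (reflexive (insertAt-lookup _ i 1#)))
                (sum-zero λ s → trans (*-congˡ (reflexive (insertAt-punchIn _ i 1# s))) (zeroʳ _)) ⟩
    g i * 1# + 0#                                             ≈⟨ +-identityʳ _ ⟩
    g i * 1#                                                  ≈⟨ *-identityʳ (g i) ⟩
    g i                                                       ∎
    where e = insertAt (λ _ → 0#) i 1#

  finite⇒≈0? : ∀ {K q} → K 0# → HasCard K q → ∀ x → K x → Dec (x ≈ 0#)
  finite⇒≈0? K0 (f , _ , f-injective , f-surjective) x Kx with f-surjective x Kx | f-surjective 0# K0
  ... | i , fi≈x | o , fo≈0 with i ≟ o
  ...   | yes ≡.refl = yes (trans (sym fi≈x) fo≈0)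
  ...   | no i≢o = no λ x≈0 → i≢o (f-injective i o (trans fi≈x (trans x≈0 (sym fo≈0))))

  finiteExtension⇒≈0? : ∀ {K q m} → K 0# → HasCard K q → ExtDegree K m → ∀ x → Dec (x ≈ 0#)
  finiteExtension⇒≈0? K0 card (e , e-independent , e-spans) x with e-spans x
  ... | c , Kc , x≈ with all? (λ i → finite⇒≈0? K0 card (c i) (Kc i))
  ...   | yes c≈0 = yes (trans x≈ (sum-zero (λ i → trans (*-congʳ (c≈0 i)) (zeroˡ _))))
  ...   | no c≉0 = no λ x≈0 → c≉0 (e-independent c Kc (trans (sym x≈) x≈0))

  -- Linear algebra over a discrete field

  module DiscreteField (isField : IsField) (_≈0? : ∀ x → Dec (x ≈ 0#)) where
    open GroupProperties +-group using (inverseʳ-unique)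

    1≉0 : ¬ 1# ≈ 0#
    1≉0 = proj₁ isField

    inv : ∀ x → ¬ x ≈ 0# → C
    inv x x≉0 = proj₁ (proj₂ isField x x≉0)

    *-inv-cancelʳ : ∀ x {z} (z≉0 : ¬ z ≈ 0#) → x * inv z z≉0 * z ≈ x
    *-inv-cancelʳ x {z} z≉0 = begin
      x * inv z z≉0 * z   ≈⟨ xy∙z≈xz∙y x _ z ⟩
      x * z * inv z z≉0   ≈⟨ *-assoc x z _ ⟩
      x * (z * inv z z≉0) ≈⟨ *-congˡ (proj₂ (proj₂ isField z z≉0)) ⟩
      x * 1#              ≈⟨ *-identityʳ x ⟩
      x                   ∎

    *-cancelʳ : ∀ {x y z} → ¬ z ≈ 0# → x * z ≈ y * z → x ≈ y
    *-cancelʳ {x} {y} {z} z≉0 xz≈yz = begin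
      x                 ≈⟨ *-inv-cancelʳ x z≉0 ⟨
      x * inv z z≉0 * z ≈⟨ xy∙z≈xz∙y x _ z ⟩
      x * z * inv z z≉0 ≈⟨ *-congʳ xz≈yz ⟩
      y * z * inv z z≉0 ≈⟨ xy∙z≈xz∙y y _ z ⟨
      y * inv z z≉0 * z ≈⟨ *-inv-cancelʳ y z≉0 ⟩
      y                 ∎

    ∈-cancel : ∀ {n} {S : Pred (V n) 0ℓ} {a y z} → IsSubspace All S → ¬ a ≈ 0# → S z →
      ((a · y) +v z) ≈v 0v → S y
    ∈-cancel {a = a} {y} {z} (S-cong , _ , _ , S-·) a≉0 Sz ay+z≈0 = S-cong y≈ (S-· tt Sz)
      where
      ay≈-z : ∀ j → a * y j ≈ - z j
      ay≈-z j = inverseʳ-unique (z j) (a * y j) (trans (+-comm _ _) (ay+z≈0 j))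
      y≈ : ((- inv a a≉0) · z) ≈v y
      y≈ j = begin
        - inv a a≉0 * z j     ≈⟨ -‿distribˡ-* _ _ ⟨
        - (inv a a≉0 * z j)   ≈⟨ -‿distribʳ-* _ _ ⟩
        inv a a≉0 * - z j     ≈⟨ *-congˡ (ay≈-z j) ⟨
        inv a a≉0 * (a * y j) ≈⟨ *-comm _ _ ⟩
        a * y j * inv a a≉0   ≈⟨ xy∙z≈yz∙x a (y j) _ ⟩
        y j * inv a a≉0 * a   ≈⟨ *-inv-cancelʳ (y j) a≉0 ⟩
        y j                   ∎

    module Projection {n} {φ : V n → C} (φ-linear : IsLinear φ) (u : V n) (φu≉0 : ¬ φ u ≈ 0#) where
      open IsLinear φ-linear

      coeff : V n → C
      coeff x = φ x * inv (φ u) φu≉0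

      proj : V n → V n
      proj x = x +v ((- coeff x) · u)

      proj-kernel : ∀ x → φ (proj x) ≈ 0#
      proj-kernel x = begin
        φ (x +v ((- coeff x) · u)) ≈⟨ +-homo x _ ⟩
        φ x + φ ((- coeff x) · u)  ≈⟨ +-congˡ (·-homo _ u) ⟩
        φ x + - coeff x * φ u      ≈⟨ +-congˡ (-‿distribˡ-* _ _) ⟨
        φ x + - (coeff x * φ u)    ≈⟨ +-congˡ (-‿cong (*-inv-cancelʳ (φ x) φu≉0)) ⟩
        φ x + - φ x                ≈⟨ -‿inverseʳ (φ x) ⟩
        0#                         ∎

      lc-proj : ∀ {d} (c : Fin d → C) (w : Fin d → V n) →
        lc c (proj ∘ w) ≈v (lc c w +v (sum (λ i → c i * - coeff (w i)) · u))
      lc-proj c w = lc-shift c (λ i → - coeff (w i)) w u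

      lc-proj-kernel : ∀ {d} (c : Fin d → C) (w : Fin d → V n) → φ (lc c (proj ∘ w)) ≈ 0#
      lc-proj-kernel c w = lc-vanishes c (proj-kernel ∘ w)

      lc-kernel : ∀ {d} (c : Fin d → C) (w : Fin d → V n) a →
        φ (lc c w +v (a · u)) ≈ 0# → (lc c w +v (a · u)) ≈v lc c (proj ∘ w)
      lc-kernel c w a φ≈0 = ≈v-trans (+v-cong (λ _ → refl) (·-congˡ u a≈σ)) (≈v-sym (lc-proj c w))
        where
        -- a and σ both solve φ (lc c w) + t * φ u ≈ 0#, which has a single solution t
        σ = sum (λ i → c i * - coeff (w i))
        solves : ∀ {t} → φ (lc c w +v (t · u)) ≈ 0# → t * φ u ≈ - φ (lc c w)
        solves {t} φ≈0 = inverseʳ-unique (φ (lc c w)) (t * φ u)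
          (trans (+-congˡ (sym (·-homo t u))) (trans (sym (+-homo _ _)) φ≈0))
        a≈σ : a ≈ σ
        a≈σ = *-cancelʳ φu≉0 (trans (solves φ≈0)
          (sym (solves (trans (φ-cong (≈v-sym (lc-proj c w))) (lc-proj-kernel c w)))))

    module Pivot {n d} {φ : V n → C} (φ-linear : IsLinear φ) (b : Fin (suc d) → V n) p
                 (φbp≉0 : ¬ φ (b p) ≈ 0#) where
      open Projection φ-linear (b p) φbp≉0 public

      b' : Fin d → V n
      b' = proj ∘ removeAt b p

      extend : (Fin d → C) → Fin (suc d) → C
      extend c = insertAt c p (sum (λ s → c s * - coeff (removeAt b p s)))

      lc-b' : ∀ c → lc c b' ≈v lc (extend c) b
      lc-b' c = ≈v-trans (lc-proj c (removeAt b p)) (≈v-sym (lc-insertAt c b p _))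

      lc-kernel-b' : ∀ a → φ (lc a b) ≈ 0# → lc a b ≈v lc (removeAt a p) b'
      lc-kernel-b' a φ≈0 = ≈v-trans (lc-removeAt a b p)
        (lc-kernel (removeAt a p) (removeAt b p) (a p) (trans (φ-cong (≈v-sym (lc-removeAt a b p))) φ≈0))
        where open IsLinear φ-linear

    dependent-by-elimination : ∀ {n r} (a : Fin (suc r) → V (suc n)) p (ap≉0 : ¬ a p zero ≈ 0#) →
      Dependent (tail ∘ Pivot.b' head-isLinear a p ap≉0) → Dependent a
    dependent-by-elimination a p ap≉0 (c , (i , ci≉0) , tails≈0) =
      extend c , (punchIn p i , ci≉0 ∘ trans (reflexive (≡.sym (insertAt-punchIn c p _ i)))) ,
      ≈v-trans (≈v-sym (lc-b' c)) lc-b'≈0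
      where
      open Pivot head-isLinear a p ap≉0
      lc-b'≈0 : lc c b' ≈v 0v
      lc-b'≈0 zero = lc-proj-kernel c (removeAt a p)
      lc-b'≈0 (suc j) = tails≈0 j

    dependent : ∀ {n r} → n ≤ r → (a : Fin (suc r) → V n) → Dependent a
    dependent {zero} _ a = (λ _ → 1#) , (zero , 1≉0) , λ ()
    dependent {suc n} {suc r} (s≤s n≤r) a with any? (λ i → ¬? (a i zero ≈0?))
    ... | yes (p , ap≉0) =
      dependent-by-elimination a p ap≉0 (dependent n≤r (tail ∘ Pivot.b' head-isLinear a p ap≉0))
    ... | no no-pivot with dependent (m≤n⇒m≤1+n n≤r) (tail ∘ a)
    ...   | c , nontrivial , tails≈0 = c , nontrivial , λ { zero → heads≈0 ; (suc j) → tails≈0 j }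
      where
      heads≈0 : sum (λ i → c i * a i zero) ≈ 0#
      heads≈0 = sum-zero λ i → trans
        (*-congˡ (decidable-stable (a i zero ≈0?) (λ ai≉0 → no-pivot (i , ai≉0)))) (zeroʳ (c i))

    independent-size : ∀ {n d} (b : Fin d → V n) → Independent All b → d ≤ n
    independent-size {d = zero} b _ = z≤n
    independent-size {n} {suc d} b b-independent with n ≤? d
    ... | no n≰d = ≰⇒> n≰d
    ... | yes n≤d with dependent n≤d b
    ...   | c , (i , ci≉0) , lc≈0 = ⊥-elim (ci≉0 (b-independent c _ lc≈0 i))

    dependent-in-span : ∀ {n N r} → N ≤ r → (b : Fin N → V n) (y : Fin (suc r) → V n) →
      (∀ k → Coordinates All b (y k)) → Dependent y
    dependent-in-span N≤r b y y-coordinates with dependent N≤r (proj₁ ∘ y-coordinates)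
    ... | c , nontrivial , lcA≈0 = c , nontrivial , ≈v-trans (lc-congʳ c (proj₂ ∘ proj₂ ∘ y-coordinates))
      (≈v-trans (lc-lc c (proj₁ ∘ y-coordinates) b) (lc-zero b lcA≈0))

    kernel⊆ : ∀ {n d} {Π : Pred (V n) 0ℓ} (B : Fin (suc d) → V n) → (∀ x → Coordinates All B x) →
      IsSubspace All Π → (P : Fin d → V n) → (∀ j → Π (P j)) → Independent All P →
      (g : V n) → Nontrivial g → (∀ j → dot g (P j) ≈ 0#) → Ker (dot g) ⊆ Π
    kernel⊆ {suc n} {Π = Π} B B-spans Π-subspace P PΠ P-independent g (i₀ , gi₀≉0) g⊥P {y} gy≈0 =
      relation⇒∈ (dependent-in-span ≤-refl B Y (B-spans ∘ Y))
      where
      open IsLinear (dot-isLinear g)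
      -- e lies outside Ker (dot g), so it cannot occur in a relation among y, e and P
      e = insertAt (λ _ → 0#) i₀ 1#
      Y = y ∷ e ∷ P

      e-coefficient≈0 : ∀ c → lc c Y ≈v 0v → c (suc zero) ≈ 0#
      e-coefficient≈0 c lc≈0 = *-cancelʳ (gi₀≉0 ∘ trans (sym (dot-unit g i₀))) (begin
        c (suc zero) * dot g e
          ≈⟨ trans (+-identityˡ _) (+-identityʳ _) ⟨
        0# + (c (suc zero) * dot g e + 0#)
          ≈⟨ +-cong (trans (*-congˡ gy≈0) (zeroʳ _))
                    (+-congˡ (sum-zero λ j → trans (*-congˡ (g⊥P j)) (zeroʳ _))) ⟨
        c zero * dot g y + (c (suc zero) * dot g e + sum (λ j → c (suc (suc j)) * dot g (P j)))
          ≈⟨ lc-homo c Y ⟨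
        dot g (lc c Y) ≈⟨ φ-cong lc≈0 ⟩
        dot g 0v       ≈⟨ 0-homo ⟩
        0#             ≈⟨ zeroˡ _ ⟨
        0# * dot g e   ∎)

      relation-without-e : ∀ c → lc c Y ≈v 0v → ((c zero · y) +v lc (tail (tail c)) P) ≈v 0v
      relation-without-e c lc≈0 j = trans (+-congˡ (sym (x≈0⇒x*y+z≈z (e-coefficient≈0 c lc≈0)))) (lc≈0 j)

      relation⇒∈ : Dependent Y → Π y
      relation⇒∈ (c , (i , ci≉0) , lc≈0) with c zero ≈0?
      ... | no c₀≉0 =
        ∈-cancel Π-subspace c₀≉0 (lc-closed Π-subspace (tail (tail c)) P _ PΠ) (relation-without-e c lc≈0)
      ... | yes c₀≈0 = ⊥-elim (ci≉0 (c≈0 i))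
        where
        c≈0 : ∀ i → c i ≈ 0#
        c≈0 zero = c₀≈0
        c≈0 (suc zero) = e-coefficient≈0 c lc≈0
        c≈0 (suc (suc j)) = P-independent (tail (tail c)) _
          (λ l → trans (sym (x≈0⇒x*y+z≈z c₀≈0)) (relation-without-e c lc≈0 l)) j

    hyperplane⇒kernel : ∀ {n} {Π : Pred (V n) 0ℓ} → IsHyperplaneOf Π Whole → ∃[ g ] Π ≐ Ker (dot g)
    hyperplane⇒kernel (_ , d , (_ , B , _ , B-independent , B-spans) ,
                       (Π-subspace , P , PΠ , P-independent , P-spans))
      with independent-size B B-independent
    -- a relation among the d + 1 columns of the basis P of Π is a normal vector of Π
    ... | s≤s d≤r with dependent d≤r (λ i j → P j i)
    ...   | g , nontrivial , g⊥P =
      g , Π⊆Ker , kernel⊆ B (λ x → B-spans x _) Π-subspace P PΠ P-independent g nontrivial g⊥P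
      where
      Π⊆Ker : ∀ {x} → _ → Ker (dot g) x
      Π⊆Ker {x} Πx with P-spans x Πx
      ... | c , _ , x≈ = trans (φ-cong x≈) (lc-vanishes c {P} g⊥P)
        where open IsLinear (dot-isLinear g)

    ∩-isHyperplaneOf : ∀ {n d} {φ : V n → C} {Π H : Pred (V n) 0ℓ} → IsLinear φ →
      IsSubspace All Π → Π ≐ Ker φ → IsSubspace All H → (b : Fin (suc d) → V n) → (∀ i → H (b i)) →
      Independent All b → (∀ x → H x → Coordinates All b x) → ∀ p → ¬ φ (b p) ≈ 0# →
      IsHyperplaneOf (Π ∩ H) H
    ∩-isHyperplaneOf {d = d} φ-linear Π-subspace (Π⊆Ker , Ker⊆Π) H-subspace@(_ , _ , H-+ , H-·)
                     b bH b-independent b-spans p φbp≉0 =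
      proj₂ , d , (H-subspace , b , bH , b-independent , b-spans) ,
      (∩-isSubspace Π-subspace H-subspace , b' , b'∈ , b'-independent , b'-spans)
      where
      open Pivot φ-linear b p φbp≉0
      b'∈ : ∀ s → _
      b'∈ s = Ker⊆Π (proj-kernel (removeAt b p s)) , H-+ (bH (punchIn p s)) (H-· tt (bH p))
      b'-independent : Independent All b'
      b'-independent c _ lc≈0 s = trans (reflexive (≡.sym (insertAt-punchIn c p _ s)))
        (b-independent (extend c) _ (≈v-trans (≈v-sym (lc-b' c)) lc≈0) (punchIn p s))
      b'-spans : ∀ y → _ → Coordinates All b' y
      b'-spans y (Πy , Hy) with b-spans y Hy
      ... | a , _ , y≈ = removeAt a p , _ ,
        ≈v-trans y≈ (lc-kernel-b' a (trans (IsLinear.φ-cong φ-linear (≈v-sym y≈)) (Π⊆Ker Πy)))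

    kernel∩⊆span-∩ : ∀ {n d} {φ : V n → C} {Π H W : Pred (V n) 0ℓ} → IsLinear φ →
      IsSubspace All Π → Π ≐ Ker φ → HasDim All H d → W ⊆ H → H ⊆ Span W →
      (∀ H' → IsHyperplaneOf H' H → Span (H' ∩ W) ≐ H') → Π ∩ H ⊆ Span (Π ∩ W)
    kernel∩⊆span-∩ {d = zero} {W = W} _ Π-subspace _ (_ , b , _ , _ , b-spans) W⊆H H⊆SW _ (_ , Hh) =
      ⊆⇒⊆-span-∩ {W = W} W⊆H H⊆SW (λ Hx → coordinates-closed {b = b} Π-subspace (λ ()) (b-spans _ Hx)) Hh
    kernel∩⊆span-∩ {d = suc d} {φ} {Π} {H} {W} φ-linear Π-subspace Π≐Ker
                   (H-subspace , b , bH , b-independent , b-spans) W⊆H H⊆SW W-cutting (Πh , Hh)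
      with any? (λ i → ¬? (φ (b i) ≈0?))
    ... | yes (p , φbp≉0) =
      span-mono {S = (Π ∩ H) ∩ W} {T = Π ∩ W} (λ ((Πw , _) , Ww) → Πw , Ww)
        (proj₂ (W-cutting _ Π∩H-hyperplane) (Πh , Hh))
      where
      Π∩H-hyperplane = ∩-isHyperplaneOf φ-linear Π-subspace Π≐Ker H-subspace b bH b-independent b-spans p φbp≉0
    ... | no φb≉0 = ⊆⇒⊆-span-∩ {W = W} W⊆H H⊆SW (λ Hx → coordinates-closed Π-subspace bΠ (b-spans _ Hx)) Hh
      where
      bΠ : ∀ i → Π (b i)
      bΠ i = proj₂ Π≐Ker (decidable-stable (φ (b i) ≈0?) (λ φbi≉0 → φb≉0 (i , φbi≉0)))

    -- The system W + ⟨v⟩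

    whole⊆kernel⊕ : ∀ {n} {φ : V n → C} {H : Pred (V n) 0ℓ} {v} → IsLinear φ → H ≐ Ker φ → ¬ H v →
      Whole ⊆ H ⊕⟨ v ⟩
    whole⊆kernel⊕ {v = v} φ-linear (_ , Ker⊆H) v∉H {x} _ =
      proj x , coeff x , Ker⊆H (proj-kernel x) , ≈v-sym (·+·-cancel x v (-‿inverseˡ (coeff x)))
      where open Projection φ-linear v (v∉H ∘ Ker⊆H)

    ⊕-hasDim : ∀ {n K t m} {H W : Pred (V n) 0ℓ} {v} → IsSubspace All H → W ⊆ H → ¬ H v →
      HasDim K W t → ExtDegree K m → HasDim K (W ⊕⟨ v ⟩) (t ℕ.+ m)
    ⊕-hasDim {n} {K} {t} {m} {W = W} {v} H-subspace W⊆H v∉H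
             (W-subspace@(_ , W-0 , _) , b , bW , b-independent , b-spans) (e , e-independent , e-spans) =
      ⊕-isSubspace v W-subspace , b ++ ev , AllV.++⁺ (W ⊕⟨ v ⟩) (λ i → ⊆-⊕ {W = W} v (bW i)) ev∈ ,
      independent , spans
      where
      ev : Fin m → V n
      ev j = e j · v
      ev∈ : ∀ j → (W ⊕⟨ v ⟩) (ev j)
      ev∈ j = 0v , e j , W-0 , λ l → sym (+-identityˡ _)

      independent : Independent K (b ++ ev)
      independent c Kc lc≈0 i = trans (reflexive (≡.sym (take++drop t c i))) (AllV.++⁺ (_≈ 0#) c₁≈0 c₂≈0 i)
        where
        c₁ = take t c
        c₂ = drop t c
        s = sum (λ j → c₂ j * e j)
        relation : (lc c₁ b +v (s · v)) ≈v 0v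
        relation = ≈v-trans (+v-cong (λ _ → refl) (≈v-sym (lc-scalars c₂ e v)))
                            (≈v-trans (≈v-sym (lc-take-drop t c b ev)) lc≈0)
        s≈0 : s ≈ 0#
        s≈0 = decidable-stable (s ≈0?) λ s≉0 → v∉H (∈-cancel H-subspace s≉0
          (W⊆H (lc-closed W-subspace c₁ b (Kc ∘ (_↑ˡ m)) bW)) (≈v-trans (+v-comm _ _) relation))
        c₂≈0 = e-independent c₂ (Kc ∘ (t ↑ʳ_)) s≈0
        c₁≈0 = b-independent c₁ (Kc ∘ (_↑ˡ m)) λ l →
          trans (sym (trans (+-comm _ _) (x≈0⇒x*y+z≈z s≈0))) (relation l)

      spans : ∀ x → (W ⊕⟨ v ⟩) x → Coordinates K (b ++ ev) x
      spans x (w , a , Ww , x≈) with b-spans w Ww | e-spans a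
      ... | c₁ , Kc₁ , w≈ | c₂ , Kc₂ , a≈ = c₁ ++ c₂ , AllV.++⁺ K Kc₁ Kc₂ ,
        ≈v-trans x≈ (≈v-trans (+v-cong w≈ (≈v-trans (·-congˡ v a≈) (≈v-sym (lc-scalars c₂ e v))))
                              (≈v-sym (lc-++ c₁ c₂ b ev)))

    ⊕-spans : ∀ {n} {H W : Pred (V n) 0ℓ} {v} → IsHyperplaneOf H Whole → H ⊆ Span W → W 0v → ¬ H v →
      Whole ⊆ Span (W ⊕⟨ v ⟩)
    ⊕-spans {W = W} {v} H-hyperplane H⊆SW W0 v∉H Wx with hyperplane⇒kernel H-hyperplane
    ... | g , H≐Ker with whole⊆kernel⊕ (dot-isLinear g) H≐Ker v∉H Wx
    ...   | h , a , Hh , x≈ = span-⊕ {W = W} v W0 (h , a , H⊆SW Hh , x≈)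

    ⊕-cutting : ∀ {n} {H W : Pred (V n) 0ℓ} {v} → IsHyperplaneOf H Whole → W 0v → W ⊆ H → H ⊆ Span W →
      (∀ H' → IsHyperplaneOf H' H → Span (H' ∩ W) ≐ H') → ¬ H v →
      ∀ Π → IsHyperplaneOf Π Whole → Span (Π ∩ (W ⊕⟨ v ⟩)) ≐ Π
    ⊕-cutting {H = H} {W} {v} H-hyperplane@(_ , _ , _ , H-dim) W0 W⊆H H⊆SW W-cutting v∉H
              Π Π-hyperplane@(_ , _ , _ , (Π-subspace@(Π-cong , _ , Π-+ , Π-·) , _))
      with hyperplane⇒kernel H-hyperplane | hyperplane⇒kernel Π-hyperplane
    ... | gH , H≐Ker | g , Π≐Ker@(Π⊆Ker , Ker⊆Π) = span-⊆ {S = Π ∩ U} Π-subspace proj₁ , Π⊆span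
      where
      U = W ⊕⟨ v ⟩
      open IsLinear (dot-isLinear g)

      v∉Π-case : ¬ dot g v ≈ 0# → ∀ {x h a} → Π x → Span W h → x ≈v (h +v (a · v)) → Span (Π ∩ U) x
      v∉Π-case gv≉0 {a = a} Πx (d , c , w , Ww , h≈) x≈ =
        d , c , proj ∘ w , (λ i → Ker⊆Π (proj-kernel (w i)) , (w i , - coeff (w i) , Ww i , λ _ → refl)) ,
        ≈v-trans x≈' (lc-kernel c w a (trans (φ-cong (≈v-sym x≈')) (Π⊆Ker Πx)))
        where
        open Projection (dot-isLinear g) v gv≉0
        x≈' = ≈v-trans x≈ (+v-cong h≈ (λ _ → refl))

      v∈Π-case : Π v → ∀ {x h a} → Π x → H h → x ≈v (h +v (a · v)) → Span (Π ∩ U) x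
      v∈Π-case Πv {h = h} {a} Πx Hh x≈ =
        span-cong {S = Π ∩ U} (≈v-sym x≈) (span-+ {S = Π ∩ U} h∈ (span-· {S = Π ∩ U} a (Πv , ∈-⊕ {W = W} v W0)))
        where
        Πh : Π h
        Πh = Π-cong (·+·-cancel h v (-‿inverseʳ a)) (Π-+ (Π-cong x≈ Πx) (Π-· tt Πv))
        h∈ : Span (Π ∩ U) h
        h∈ = span-mono {S = Π ∩ W} {T = Π ∩ U} (λ (Πw , Ww) → Πw , ⊆-⊕ {W = W} v Ww)
          (kernel∩⊆span-∩ (dot-isLinear g) Π-subspace Π≐Ker H-dim W⊆H H⊆SW W-cutting (Πh , Hh))

      Π⊆span : Π ⊆ Span (Π ∩ U)
      Π⊆span {x} Πx with whole⊆kernel⊕ (dot-isLinear gH) H≐Ker v∉H {x} tt | dot g v ≈0?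
      ... | h , a , Hh , x≈ | no gv≉0 = v∉Π-case gv≉0 Πx (H⊆SW Hh) x≈
      ... | h , a , Hh , x≈ | yes gv≈0 = v∈Π-case (Ker⊆Π gv≈0) Πx Hh x≈

open import Data.Nat using (_+_)

proposition3p7 : (F : CommutativeRing 0ℓ 0ℓ) → let open Lin F in
    IsField → (K : Pred (CommutativeRing.Carrier F) 0ℓ) → IsSubfield K →
    (q : ℕ) → IsPrimePower q → HasCard K q →
    (m : ℕ) → 1 ≤ m → ExtDegree K m →
    (k : ℕ) → 1 ≤ k →
    (H : Pred (V (suc k)) 0ℓ) → IsHyperplaneOf H Whole →
    (W : Pred (V (suc k)) 0ℓ) → W ⊆ H → (t : ℕ) → HasDim K W t →
    Span W ≐ H →
    (∀ (H' : Pred (V (suc k)) 0ℓ) → IsHyperplaneOf H' H → Span (H' ∩ W) ≐ H') →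
    (v : V (suc k)) → ¬ H v →
    IsCuttingSystem K (t + m) (suc k) (W ⊕⟨ v ⟩)
proposition3p7 F isField K (_ , K0 , _) q _ K-card m _ F/K-degree k _
               H H-hyperplane@(_ , _ , _ , H-subspace , _) W W⊆H t W-dim@((_ , W0 , _) , _)
               (_ , H⊆SW) W-cutting v v∉H =
  (⊕-hasDim H-subspace W⊆H v∉H W-dim F/K-degree , ⊕-spans H-hyperplane H⊆SW W0 v∉H) ,
  ⊕-cutting H-hyperplane W0 W⊆H H⊆SW W-cutting v∉H
  where
  open LinearAlgebra F
  open DiscreteField isField (finiteExtension⇒≈0? K0 K-card F/K-degree)
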